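{- Let $T$ be a tournament, $R$ a minimal $\tau$-retentive set of $T$, and $v,u\in R$. Then $v$ is the captain of $u$ in $T[R]$ if and only if $v$ is the captain of $u$ in $T$.
   Context: A tournament $T$ consists of a finite vertex set $V(T)$ and an asymmetric, complete binary relation $\succ$ on $V(T)$ ($x$ dominates $y$ if $x\succ y$). For $v\in V(T)$ let $N^-_T(v)=\{u: u\succ v\}$; for $B\subseteq V(T)$, $T[B]$ is the induced subtournament. In a tournament $S$, a vertex $v$ is the captain of a vertex $u$ if $v\succ u$ and $v\succ w$ for every $w\in N^-_S(u)\setminus\{v\}$. The tournament equilibrium set $\tau$ is defined recursively: a nonempty $A\subseteq V(T)$ is $\tau$-retentive if for every $x\in A$ with $N^-_T(x)\neq\emptyset$, $\tau(T[N^-_T(x)])\subseteq A$; $A$ is a minimal $\tau$-retentive set if no $\tau$-retentive set of $T$ is a proper subset of $A$; $\tau(T)$ is the union of all minimal $\tau$-retentive sets of $T$. -}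

module Defs where

open import Level using (0ℓ)
open import Data.Nat using (ℕ; zero; suc)
open import Data.Fin using (Fin)
open import Data.Product using (_×_; ∃)
open import Data.Sum using (_⊎_)
open import Relation.Nullary using (¬_)
open import Data.Empty.Polymorphic using (⊥)
open import Relation.Binary.PropositionalEquality using (_≡_; _≢_)
open import Relation.Unary using (Pred; _∈_; _⊆_; Satisfiable; ∅; U)

record Tournament (n : ℕ) : Set₁ where
  field
    _≻_      : Fin n → Fin n → Set
    asym     : ∀ {x y} → x ≻ y → ¬ (y ≻ x)
    complete : ∀ {x y} → x ≢ y → (x ≻ y) ⊎ (y ≻ x)

-- Subsets of V(T) are predicates; a subset B stands for the induced
-- subtournament T[B].
VSet : ℕ → Set₁
VSet n = Pred (Fin n) 0ℓ

module _ {n : ℕ} (T : Tournament n) where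
  open Tournament T

  InNbr : VSet n → Fin n → VSet n
  InNbr B x u = (u ∈ B) × (u ≻ x)

  -- τ(T[B]) computed with a fuel parameter k.  Since x ∉ N^-(x), each
  -- recursive call is on a strictly smaller vertex set, so whenever
  -- k ≥ |B| the fuel never runs out prematurely and τ k B = τ(T[B]).
  -- (For k = 0 we have |B| = 0 and τ of the empty set is empty.)
  mutual
    Retentive : ℕ → VSet n → VSet n → Set₁
    Retentive k B A =
      (A ⊆ B) × Satisfiable A ×
      (∀ {x} → x ∈ A → Satisfiable (InNbr B x) → τ k (InNbr B x) ⊆ A)

    MinRetentive : ℕ → VSet n → VSet n → Set₁
    MinRetentive k B A =
      Retentive k B A × (∀ A' → Retentive k B A' → A' ⊆ A → A ⊆ A')

    τ : ℕ → VSet n → Pred (Fin n) (Level.suc 0ℓ)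
    τ zero    B y = ⊥
    τ (suc k) B y = ∃ λ (A : VSet n) → MinRetentive k B A × (y ∈ A)

  -- The whole vertex set V(T) and the τ-notions for T itself
  -- (fuel n ≥ |V(T)|).
  IsMinTauRetentive : VSet n → Set₁
  IsMinTauRetentive A = MinRetentive n U A

  Captain : VSet n → Fin n → Fin n → Set
  Captain B v u = (v ≻ u) × (∀ w → w ∈ InNbr B u → w ≢ v → v ≻ w)

-- Let w ≻ u with w ≠ v.  If also w ≻ v, take a minimal τ-retentive set A
-- of T[N⁻(u)]; since u ∈ R and R is τ-retentive, A ⊆ R.  Either v ∈ A, and
-- then τ(T[N⁻(u) ∩ N⁻(v)]) ⊆ A ⊆ R supplies a vertex of R dominating u and v,
-- or v ∉ A, and then v dominates all of A, which is impossible for a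
-- τ-retentive set (descend through the in-neighbourhoods of its vertices).
-- So v ≻ w.  Membership and dominance are not
-- decidable here, but every classical step has a contradiction as its goal,
-- so it is carried out under double negation.
module Submission where

open import Defs
open import Data.Nat using (ℕ)
open import Data.Fin using (Fin)
open import Relation.Unary using (_∈_; U)
open import Function.Bundles using (_⇔_)

open import Level using (Level)
open import Data.Nat using (zero; suc; _≤_; s≤s⁻¹)
open import Data.Nat.Properties using (<-≤-trans; ≤-reflexive)
open import Data.Fin.Properties using (_≟_; sequence)
open import Data.List using ([]; _∷_; length; filter; allFin)
open import Data.List.Properties using (filter-notAll; length-tabulate)
open import Data.List.Relation.Unary.Any as Any using (any?; satisfied)
open import Data.List.Membership.Propositional using (lose) renaming (_∈_ to _∈ₗ_)
open import Data.List.Membership.Propositional.Properties using (∈-filter⁺; ∈-allFin)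
open import Data.Product using (∃-syntax; _×_; _,_; proj₁; proj₂)
open import Data.Sum using (inj₁; inj₂)
open import Data.Empty using (⊥-elim)
open import Data.Unit using (tt)
open import Effect.Monad using (RawMonad)
open import Function using (_∘_)
open import Relation.Binary.Core using (Rel)
open import Relation.Binary.Definitions using (Reflexive; Transitive; Decidable; DecidableEquality)
open import Relation.Binary.Construct.Closure.ReflexiveTransitive using (Star; ε; _◅_; _◅◅_)
open import Relation.Binary.PropositionalEquality using (_≢_; refl; sym)
open import Relation.Nullary using (¬_; Dec; yes; no; _×-dec_; ¬?)
open import Relation.Nullary.Decidable using (True; toWitness; fromWitness; decidable-stable; ¬¬-excluded-middle)
open import Relation.Nullary.Negation using (¬¬-Monad)
open import Relation.Unary using (Pred; Satisfiable; _⊆_; _∉_)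
open import Function.Bundles using (mk⇔)

private
  variable
    a ℓ : Level
    A : Set a
    k n : ℕ

¬¬-decidable-Fin : {_∼_ : Rel (Fin n) ℓ} → ¬ ¬ Decidable _∼_
¬¬-decidable-Fin = sequence¬¬ λ _ → sequence¬¬ λ _ → ¬¬-excluded-middle
  where sequence¬¬ = sequence (RawMonad.rawApplicative ¬¬-Monad)

∣_∣≤_ : Pred A ℓ → ℕ → Set _
∣ P ∣≤ k = ∃[ xs ] (∀ {x} → x ∈ P → x ∈ₗ xs) × length xs ≤ k

∣∣≤0⇒empty : {P : Pred A ℓ} {x : A} → ∣ P ∣≤ 0 → x ∉ P
∣∣≤0⇒empty ([] , cover , _) x∈P with () ← cover x∈P
∣∣≤0⇒empty (_ ∷ _ , _ , ()) _

∣∣≤-⊂ : DecidableEquality A → {P Q : Pred A ℓ} {x : A} →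
        ∣ P ∣≤ suc k → x ∈ P → Q ⊆ P → x ∉ Q → ∣ Q ∣≤ k
∣∣≤-⊂ _≟ₐ_ {x = x} (xs , cover , length≤) x∈P Q⊆P x∉Q =
  filter (λ y → ¬? (y ≟ₐ x)) xs ,
  (λ y∈Q → ∈-filter⁺ (λ y → ¬? (y ≟ₐ x)) (cover (Q⊆P y∈Q)) λ { refl → x∉Q y∈Q }) ,
  s≤s⁻¹ (<-≤-trans (filter-notAll _ xs (Any.map (λ { refl ¬x≡x → ¬x≡x refl }) (cover x∈P))) length≤)

∣Fin∣≤ : (P : Pred (Fin n) ℓ) → ∣ P ∣≤ n
∣Fin∣≤ {n} _ = allFin n , (λ {x} _ → ∈-allFin x) , ≤-reflexive (length-tabulate _)

module _ {_≲_ : Rel A ℓ} (≲-refl : Reflexive _≲_) (≲-trans : Transitive _≲_)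
         (_≲?_ : Decidable _≲_) (_≟ₐ_ : DecidableEquality A) where

  maximal-above : {x : A} → ∣ x ≲_ ∣≤ k → ∃[ s ] x ≲ s × (∀ {y} → s ≲ y → y ≲ s)
  maximal-above {zero} bound = ⊥-elim (∣∣≤0⇒empty bound ≲-refl)
  maximal-above {suc k} {x} bound@(xs , cover , _)
    with any? (λ y → (x ≲? y) ×-dec ¬? (y ≲? x)) xs
  ... | yes escapes =
    let y , x≲y , y≴x = satisfied escapes
        s , y≲s , s-maximal = maximal-above (∣∣≤-⊂ _≟ₐ_ bound ≲-refl (≲-trans x≲y) y≴x)
    in s , ≲-trans x≲y y≲s , s-maximal
  ... | no stays = x , ≲-refl , λ {y} x≲y →
    decidable-stable (y ≲? x) λ y≴x → stays (lose (cover x≲y) (x≲y , y≴x))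

module _ {n : ℕ} (T : Tournament n) where
  open Tournament T

  private
    variable
      B R : VSet n
      u v x y : Fin n

  τ-⊆ : ∀ k B → τ T k B ⊆ B
  τ-⊆ zero    B ()
  τ-⊆ (suc k) B (A , ((A⊆B , _) , _) , y∈A) = A⊆B y∈A

  TauStep : ℕ → VSet n → Rel (Fin n) _
  TauStep k B x = τ T k (InNbr T B x)

  Reach : ℕ → VSet n → Rel (Fin n) _
  Reach k B = Star (TauStep k B)

  Reach-⊆ : x ∈ B → Reach k B x y → y ∈ B
  Reach-⊆ x∈B ε = x∈B
  Reach-⊆ {k = k} _ (step ◅ steps) = Reach-⊆ (proj₁ (τ-⊆ k _ step)) steps

  Retentive⇒Reach-closed : {A : VSet n} → Retentive T k B A → x ∈ A → Reach k B x y → y ∈ A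
  Retentive⇒Reach-closed _ x∈A ε = x∈A
  Retentive⇒Reach-closed {k = k} ret@(_ , _ , closed) x∈A (step ◅ steps) =
    Retentive⇒Reach-closed ret (closed x∈A (_ , τ-⊆ k _ step) step) steps

  -- Reach is Set₁-valued; deciding it brings the reachable set down to a VSet.
  Reach-maximal⇒MinRetentive : {s : Fin n} → s ∈ B → (∀ {y} → Reach k B s y → Reach k B y s) →
    (Reach? : ∀ y → Dec (Reach k B s y)) → MinRetentive T k B (λ y → True (Reach? y))
  Reach-maximal⇒MinRetentive {s = s} s∈B s-maximal Reach? =
    ( (λ y∈A → Reach-⊆ s∈B (toWitness y∈A))
    , (s , fromWitness ε)
    , (λ x∈A _ step → fromWitness (toWitness x∈A ◅◅ (step ◅ ε))) )
    , λ { A' ret'@(_ , (a , a∈A') , _) A'⊆A y∈A →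
          Retentive⇒Reach-closed ret' a∈A' (s-maximal (toWitness (A'⊆A a∈A')) ◅◅ toWitness y∈A) }

  minRetentive-exists : x ∈ B → ¬ ¬ (∃[ A ] MinRetentive T k B A)
  minRetentive-exists {x} {B} {k} x∈B ¬exists = ¬¬-decidable-Fin λ Reach? →
    let s , x↝s , s-maximal = maximal-above ε _◅◅_ Reach? _≟_ (∣Fin∣≤ (Reach k B x))
    in ¬exists (_ , Reach-maximal⇒MinRetentive (Reach-⊆ x∈B x↝s) s-maximal (Reach? s))

  τ-nonempty : ∣ B ∣≤ k → x ∈ B → ¬ ¬ Satisfiable (τ T k B)
  τ-nonempty {k = zero} bound x∈B _ = ∣∣≤0⇒empty bound x∈B
  τ-nonempty {k = suc k} _ x∈B ¬nonempty = minRetentive-exists x∈B λ (A , minA) →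
    let y , y∈A = proj₁ (proj₂ (proj₁ minA)) in ¬nonempty (y , A , minA , y∈A)

  retentive-undominated : {A : VSet n} → ∣ B ∣≤ k → Retentive T k B A → x ∈ B →
    ¬ (∀ {a} → a ∈ A → x ≻ a)
  retentive-undominated {k = zero} bound (A⊆B , (a , a∈A) , _) _ _ =
    ∣∣≤0⇒empty bound (A⊆B a∈A)
  retentive-undominated {B} {suc k} {x} bound (A⊆B , (a , a∈A) , closed) x∈B x≻A =
    minRetentive-exists x∈Na λ (A' , minA'@(ret' , _)) →
      let A'⊆A : A' ⊆ _
          A'⊆A y∈A' = closed a∈A (x , x∈Na) (A' , minA' , y∈A')
      in retentive-undominated (∣∣≤-⊂ _≟_ bound (A⊆B a∈A) proj₁ a∉Na) ret' x∈Na (x≻A ∘ A'⊆A)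
    where
    x∈Na : x ∈ InNbr T B a
    x∈Na = x∈B , x≻A a∈A
    a∉Na : a ∉ InNbr T B a
    a∉Na (_ , a≻a) = asym a≻a a≻a

  Captain-restrict : R ⊆ B → Captain T B v u → Captain T R v u
  Captain-restrict R⊆B (v≻u , v≻N) = v≻u , λ w (w∈R , w≻u) → v≻N w (R⊆B w∈R , w≻u)

  Captain-extend : ∣ B ∣≤ k → Retentive T k B R → u ∈ R → v ∈ R →
    Captain T R v u → Captain T B v u
  Captain-extend {k = zero} bound (R⊆B , _) u∈R _ _ = ⊥-elim (∣∣≤0⇒empty bound (R⊆B u∈R))
  Captain-extend {B} {suc k} {R} {u} {v} bound (R⊆B , _ , closed) u∈R v∈R (v≻u , v≻N) =
    v≻u , v≻
    where
    u∉Nu : u ∉ InNbr T B u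
    u∉Nu (_ , u≻u) = asym u≻u u≻u

    no-common-dominator : ∀ {w} → w ∈ InNbr T B u → ¬ (w ≻ v)
    no-common-dominator {w} w∈Nu w≻v = minRetentive-exists w∈Nu λ
      (A , minA@(retA@(A⊆Nu , _ , closedA) , _)) →
      let A⊆R : A ⊆ R
          A⊆R y∈A = closed u∈R (w , w∈Nu) (A , minA , y∈A)
      in ¬¬-excluded-middle λ
      { (yes v∈A) →
          τ-nonempty (∣∣≤-⊂ _≟_ bound (R⊆B u∈R) (proj₁ ∘ proj₁) (u∉Nu ∘ proj₁)) (w∈Nu , w≻v)
            λ (y , y∈τ) →
              let (_ , y≻u) , y≻v = τ-⊆ k _ y∈τ
                  y∈A = closedA v∈A (w , w∈Nu , w≻v) y∈τ
              in asym (v≻N y (A⊆R y∈A , y≻u) λ { refl → asym y≻v y≻v }) y≻v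
      ; (no v∉A) →
          retentive-undominated (∣∣≤-⊂ _≟_ bound (R⊆B u∈R) proj₁ u∉Nu) retA (R⊆B v∈R , v≻u)
            λ a∈A → v≻N _ (A⊆R a∈A , proj₂ (A⊆Nu a∈A)) λ { refl → v∉A a∈A }
      }

    v≻ : ∀ w → w ∈ InNbr T B u → w ≢ v → v ≻ w
    v≻ w w∈Nu w≢v with complete (w≢v ∘ sym)
    ... | inj₁ v≻w = v≻w
    ... | inj₂ w≻v = ⊥-elim (no-common-dominator w∈Nu w≻v)

lemma5 : (n : ℕ) (T : Tournament n) (R : VSet n) →
         IsMinTauRetentive T R →
         (v u : Fin n) → v ∈ R → u ∈ R →
         Captain T R v u ⇔ Captain T U v u
lemma5 n T R (retR , _) v u v∈R u∈R =
  mk⇔ (Captain-extend T (∣Fin∣≤ U) retR u∈R v∈R) (Captain-restrict T λ _ → tt)
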